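{- Let $q$ be a prime power, $n,r$ positive integers, and $U_1,\ldots,U_r$ $\mathbb{F}_q$-subspaces of $\mathbb{F}_{q^n}$ with $k_i=\dim_{\mathbb{F}_q}(U_i)\geq 2$ for all $i$ and $\sum_{i=1}^rk_i=k\leq(r-1)n$. Let $U=U_1\times\cdots\times U_r\subseteq\mathbb{F}_{q^n}^r$ and $P_i=\langle\mathbf{e}_i\rangle_{\mathbb{F}_{q^n}}$, where $\mathbf{e}_i$ is the $i$-th standard basis vector. The following are equivalent: (i) every point of $L_U$ different from $P_1,\ldots,P_r$ has weight one in $L_U$; (ii) $U_i\cdot U_i^{ -1}\cap U_j\cdot U_j^{ -1}=\mathbb{F}_q$ for all $i\neq j$; (iii) $\dim_{\mathbb{F}_q}(U_i\cap\alpha U_j)\leq 1$ for every $\alpha\in\mathbb{F}_{q^n}^*$ and all $i\neq j$.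
   Context: $U^{ -1}=\{u^{ -1}:u\in U\setminus\{0\}\}$, $U\cdot V=\{uv:u\in U,v\in V\}$. For an $\mathbb{F}_q$-subspace $W$ of $\mathbb{F}_{q^n}^r$, $L_W=\{\langle\mathbf{w}\rangle_{\mathbb{F}_{q^n}}:\mathbf{w}\in W\setminus\{\mathbf{0}\}\}\subseteq\mathrm{PG}(r-1,q^n)$ and $w_{L_W}(\langle\mathbf{v}\rangle_{\mathbb{F}_{q^n}})=\dim_{\mathbb{F}_q}(W\cap\langle\mathbf{v}\rangle_{\mathbb{F}_{q^n}})$. -}

module Defs where

open import Level using (0ℓ)
open import Data.Nat using (ℕ; zero; suc; _≤_; _∸_; _^_) renaming (_*_ to _*ℕ_)
open import Data.Nat.Primality using (Prime)
open import Data.Fin using (Fin)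
open import Data.List using (List; length)
open import Data.List.Membership.Propositional using (_∈_)
open import Data.List.Relation.Unary.Unique.Propositional using (Unique)
open import Data.Vec using (Vec; []; _∷_; lookup; map)
open import Data.Vec.Relation.Unary.All using (All)
open import Data.Product using (Σ; ∃; ∃-syntax; _×_; _,_)
open import Relation.Binary.PropositionalEquality using (_≡_; _≢_)
open import Relation.Nullary using (¬_; Dec)
open import Relation.Unary using (Pred)
open import Algebra.Structures using (IsCommutativeRing)
import Data.Unit
import Data.Nat

IsPrimePower : ℕ → Set
IsPrimePower q = Σ ℕ λ p → Σ ℕ λ e → Prime p × 1 ≤ e × q ≡ p ^ e

Card : {A : Set} → Pred A 0ℓ → ℕ → Set
Card {A} P m = Σ (List A) λ xs →
  Unique xs × (∀ x → P x → x ∈ xs) × (∀ x → x ∈ xs → P x) × length xs ≡ m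

record Field : Set₁ where
  infixl 7 _*_
  infixl 6 _+_
  field
    Carrier : Set
    _+_ _*_ : Carrier → Carrier → Carrier
    -_ : Carrier → Carrier
    0# 1# : Carrier
    _⁻¹ : Carrier → Carrier
    isCommutativeRing : IsCommutativeRing _≡_ _+_ _*_ -_ 0# 1#
    0≢1 : 0# ≢ 1#
    inverseʳ : ∀ x → x ≢ 0# → x * (x ⁻¹) ≡ 1#
    _≟_ : (x y : Carrier) → Dec (x ≡ y)

module _ (F : Field) where
  open Field F

  record IsSubfield (K : Pred Carrier 0ℓ) : Set where
    field
      0∈ : K 0#
      1∈ : K 1#
      +-closed : ∀ {x y} → K x → K y → K (x + y)
      *-closed : ∀ {x y} → K x → K y → K (x * y)
      neg-closed : ∀ {x} → K x → K (- x)
      inv-closed : ∀ {x} → K x → x ≢ 0# → K (x ⁻¹)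

  zeroV : ∀ {r} → Vec Carrier r
  zeroV {zero} = []
  zeroV {suc r} = 0# ∷ zeroV

  _+V_ : ∀ {r} → Vec Carrier r → Vec Carrier r → Vec Carrier r
  [] +V [] = []
  (x ∷ xs) +V (y ∷ ys) = (x + y) ∷ (xs +V ys)

  _•V_ : ∀ {r} → Carrier → Vec Carrier r → Vec Carrier r
  a •V v = map (a *_) v

  e : ∀ {r} → Fin r → Vec Carrier r
  e {suc r} Fin.zero = 1# ∷ zeroV
  e {suc r} (Fin.suc i) = 0# ∷ e i

  -- Generic "F-vector-space operations" on a type V; only scalars from K are used
  -- when speaking of K-subspaces and K-dimension.
  record VOps (V : Set) : Set where
    field
      vzero : V
      _⊕_ : V → V → V
      _•_ : Carrier → V → V

  opsF : VOps Carrier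
  opsF = record { vzero = 0# ; _⊕_ = _+_ ; _•_ = _*_ }

  opsVec : ∀ r → VOps (Vec Carrier r)
  opsVec r = record { vzero = zeroV ; _⊕_ = _+V_ ; _•_ = _•V_ }

  module _ (K : Pred Carrier 0ℓ) {V : Set} (O : VOps V) where
    open VOps O

    lincomb : ∀ {k} → Vec Carrier k → Vec V k → V
    lincomb [] [] = vzero
    lincomb (c ∷ cs) (b ∷ bs) = (c • b) ⊕ lincomb cs bs

    record IsSubspace (W : Pred V 0ℓ) : Set where
      field
        zero∈ : W vzero
        ⊕-closed : ∀ {x y} → W x → W y → W (x ⊕ y)
        •-closed : ∀ {a x} → K a → W x → W (a • x)

    HasDim : Pred V 0ℓ → ℕ → Set
    HasDim W k = Σ (Vec V k) λ b →
        All W b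
      × (∀ (c : Vec Carrier k) → All K c → lincomb c b ≡ vzero → All (_≡ 0#) c)
      × (∀ w → W w → Σ (Vec Carrier k) λ c → All K c × w ≡ lincomb c b)

    DimAtMost : Pred V 0ℓ → ℕ → Set
    DimAtMost W d = Σ ℕ λ k → k ≤ d × HasDim W k

  _·_⁻¹ˢ : Pred Carrier 0ℓ → Pred Carrier 0ℓ → Pred Carrier 0ℓ
  (U · U' ⁻¹ˢ) x = Σ Carrier λ u → Σ Carrier λ u' → U u × U' u' × u' ≢ 0# × x ≡ u * (u' ⁻¹)

  scaleSet : Carrier → Pred Carrier 0ℓ → Pred Carrier 0ℓ
  scaleSet α U x = Σ Carrier λ u → U u × x ≡ α * u

  prodSpace : ∀ {r} → (Fin r → Pred Carrier 0ℓ) → Pred (Vec Carrier r) 0ℓ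
  prodSpace Us v = ∀ i → Us i (lookup v i)

  span1 : ∀ {r} → Vec Carrier r → Pred (Vec Carrier r) 0ℓ
  span1 v w = Σ Carrier λ a → w ≡ a •V v

  _∩_ : {A : Set} → Pred A 0ℓ → Pred A 0ℓ → Pred A 0ℓ
  (P ∩ Q) x = P x × Q x

sumℕ : ∀ {r} → Vec ℕ r → ℕ
sumℕ [] = 0
sumℕ (x ∷ xs) = x Data.Nat.+ sumℕ xs

⊤′ : (F : Field) → Pred (Field.Carrier F) 0ℓ
⊤′ F _ = Data.Unit.⊤

-- Say that x multiplies U when x b ∈ U for some nonzero b ∈ U; these are exactly the
-- elements of U·U⁻¹.  All three conditions say that no x ∉ 𝔽_q multiplies two different
-- U_i, U_j.  A point ⟨v⟩ of L_U off the P_i has two nonzero coordinates v_i, v_j, and its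
-- weight exceeds one exactly when some x ∉ 𝔽_q has x v ∈ U, i.e. multiplies U_i (at v_i)
-- and U_j (at v_j).  Likewise U_i ∩ αU_j has dimension at least two exactly when it
-- contains some b ≠ 0 together with x b for an x ∉ 𝔽_q, and then x multiplies U_i at b and
-- U_j at α⁻¹b.
module Submission where

open import Defs
open import Level using (0ℓ)
open import Data.Nat using (ℕ; _≤_; _∸_; _^_; _*_)
open import Data.Fin using (Fin)
open import Data.Vec using (Vec; lookup)
open import Data.Product using (Σ; _×_)
open import Relation.Binary.PropositionalEquality using (_≡_; _≢_)
open import Relation.Nullary using (¬_)
open import Relation.Unary using (Pred)
open import Function.Bundles using (_⇔_)

open import Data.Nat using (zero; suc; z≤n; s≤s)
open import Data.Nat.Properties using (≤-refl; <⇒≤)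
open import Data.Fin using (zero; suc) renaming (_≟_ to _≟ᶠ_)
open import Data.Fin.Properties using (any?)
open import Data.Vec using ([]; _∷_; tabulate)
open import Data.Vec.Properties using (lookup-map; lookup∘tabulate; tabulate∘lookup; tabulate-cong; map-id; map-cong)
open import Data.Vec.Relation.Unary.All using (All; []; _∷_)
open import Data.List.Relation.Unary.Any using () renaming (any? to anyˡ?)
open import Data.List.Membership.Propositional using (find; lose)
open import Data.Product using (∃-syntax; _,_)
open import Data.Empty using (⊥-elim)
open import Data.Unit using (tt)
open import Function using (_∘_)
open import Function.Bundles using (mk⇔; Equivalence)
import Function.Properties.Equivalence as ⇔
open import Relation.Binary.PropositionalEquality using (refl; sym; trans; cong; cong₂; subst; module ≡-Reasoning)
open import Relation.Nullary using (Dec; yes; no; ¬?)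
open import Relation.Nullary.Decidable using (map′; _×-dec_; decidable-stable)
open import Relation.Unary using (Decidable)
open import Algebra.Bundles using (CommutativeSemigroup)
open import Algebra.Structures using (IsCommutativeRing)
import Algebra.Properties.CommutativeSemigroup as CommutativeSemigroupProperties

∃-finite? : ∀ {A : Set} {P : Pred A 0ℓ} {m} → Card P m → ∀ {Q : Pred A 0ℓ} → Decidable Q
  → Dec (∃[ x ] P x × Q x)
∃-finite? (xs , _ , complete , sound , _) Q? = map′
  (λ some-x → let x , x∈xs , q = find some-x in x , sound x x∈xs , q)
  (λ (x , p , q) → lose (complete x p) q)
  (anyˡ? Q? xs)

module FieldProperties (F : Field) where
  open Field F renaming (_*_ to _⋆_)
  open IsCommutativeRing isCommutativeRing
    using (+-identityʳ; *-assoc; *-comm; *-identityˡ; *-identityʳ; zeroˡ; zeroʳ; *-isCommutativeSemigroup)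
  open ≡-Reasoning

  *-commutativeSemigroup : CommutativeSemigroup 0ℓ 0ℓ
  *-commutativeSemigroup = record
    { Carrier = Carrier ; _≈_ = _≡_ ; _∙_ = _⋆_ ; isCommutativeSemigroup = *-isCommutativeSemigroup }

  open CommutativeSemigroupProperties *-commutativeSemigroup using (x∙yz≈y∙xz)

  infixl 7 _/_
  _/_ : Carrier → Carrier → Carrier
  x / y = x ⋆ y ⁻¹

  x/y⋆y≡x : ∀ x {y} → y ≢ 0# → x / y ⋆ y ≡ x
  x/y⋆y≡x x {y} y≢0 = begin
    x ⋆ y ⁻¹ ⋆ y   ≡⟨ *-assoc x _ y ⟩
    x ⋆ (y ⁻¹ ⋆ y) ≡⟨ cong (x ⋆_) (trans (*-comm _ y) (inverseʳ y y≢0)) ⟩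
    x ⋆ 1#         ≡⟨ *-identityʳ x ⟩
    x              ∎

  /-unique : ∀ {x y z} → y ≢ 0# → z ⋆ y ≡ x → x / y ≡ z
  /-unique {x} {y} {z} y≢0 z⋆y≡x = begin
    x ⋆ y ⁻¹       ≡⟨ cong (_⋆ y ⁻¹) z⋆y≡x ⟨
    z ⋆ y ⋆ y ⁻¹   ≡⟨ *-assoc z y _ ⟩
    z ⋆ (y ⋆ y ⁻¹) ≡⟨ cong (z ⋆_) (inverseʳ y y≢0) ⟩
    z ⋆ 1#         ≡⟨ *-identityʳ z ⟩
    z              ∎

  x⋆y≡0⇒x≡0 : ∀ {x y} → y ≢ 0# → x ⋆ y ≡ 0# → x ≡ 0#
  x⋆y≡0⇒x≡0 {x} {y} y≢0 x⋆y≡0 = begin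
    x          ≡⟨ /-unique y≢0 refl ⟨
    x ⋆ y / y  ≡⟨ cong (_/ y) x⋆y≡0 ⟩
    0# / y     ≡⟨ zeroˡ _ ⟩
    0#         ∎

  /≢0 : ∀ {x y} → x ≢ 0# → y ≢ 0# → x / y ≢ 0#
  /≢0 {x} {y} x≢0 y≢0 x/y≡0 = x≢0 (begin
    x          ≡⟨ x/y⋆y≡x x y≢0 ⟨
    x / y ⋆ y  ≡⟨ cong (_⋆ y) x/y≡0 ⟩
    0# ⋆ y     ≡⟨ zeroˡ y ⟩
    0#         ∎)

  quotients : Pred Carrier 0ℓ → Pred Carrier 0ℓ
  quotients U = _·_⁻¹ˢ F U U

  Multiplier : Pred Carrier 0ℓ → Pred Carrier 0ℓ
  Multiplier U x = ∃[ b ] b ≢ 0# × U b × U (x ⋆ b)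

  quotient⇔multiplier : ∀ {U x} → quotients U x ⇔ Multiplier U x
  quotient⇔multiplier {U} {x} = mk⇔
    (λ (a , b , a∈U , b∈U , b≢0 , x≡a/b) →
       b , b≢0 , b∈U , subst U (trans (sym (x/y⋆y≡x a b≢0)) (cong (_⋆ b) (sym x≡a/b))) a∈U)
    (λ (b , b≢0 , b∈U , xb∈U) → x ⋆ b , b , xb∈U , b∈U , b≢0 , sym (/-unique b≢0 refl))

  scaled-∩? : ∀ {U V α} → α ≢ 0# → Decidable U → Decidable V → Decidable (_∩_ F U (scaleSet F α V))
  scaled-∩? {U} {V} {α} α≢0 U? V? x = map′
    (λ (x∈U , x/α∈V) → x∈U , x / α , x/α∈V , sym (trans (*-comm α _) (x/y⋆y≡x x α≢0)))
    (λ (x∈U , u , u∈V , x≡αu) → x∈U , subst V (sym (/-unique α≢0 (trans (*-comm u α) (sym x≡αu)))) u∈V)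
    (U? x ×-dec V? (x / α))

  lookup-zeroV : ∀ {r} (i : Fin r) → lookup (zeroV F) i ≡ 0#
  lookup-zeroV zero    = refl
  lookup-zeroV (suc i) = lookup-zeroV i

  lookup-•V : ∀ {r} a (v : Vec Carrier r) i → lookup (_•V_ F a v) i ≡ a ⋆ lookup v i
  lookup-•V a v i = lookup-map i (a ⋆_) v

  lookup-e-≢ : ∀ {r} {i j : Fin r} → i ≢ j → lookup (e F i) j ≡ 0#
  lookup-e-≢ {i = zero}  {zero}  i≢j = ⊥-elim (i≢j refl)
  lookup-e-≢ {i = zero}  {suc j} _   = lookup-zeroV j
  lookup-e-≢ {i = suc i} {zero}  _   = refl
  lookup-e-≢ {i = suc i} {suc j} i≢j = lookup-e-≢ (i≢j ∘ cong suc)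

  lookup-e-≡ : ∀ {r} (i : Fin r) → lookup (e F i) i ≡ 1#
  lookup-e-≡ zero    = refl
  lookup-e-≡ (suc i) = lookup-e-≡ i

  ≡-by-lookup : ∀ {r} {u v : Vec Carrier r} → (∀ i → lookup u i ≡ lookup v i) → u ≡ v
  ≡-by-lookup {u = u} {v} u≗v = trans (sym (tabulate∘lookup u)) (trans (tabulate-cong u≗v) (tabulate∘lookup v))

  +V-identityʳ : ∀ {r} (v : Vec Carrier r) → _+V_ F v (zeroV F) ≡ v
  +V-identityʳ []      = refl
  +V-identityʳ (x ∷ v) = cong₂ _∷_ (+-identityʳ x) (+V-identityʳ v)

  •V-identityˡ : ∀ {r} (v : Vec Carrier r) → _•V_ F 1# v ≡ v
  •V-identityˡ v = trans (map-cong *-identityˡ v) (map-id v)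

  coordinate≢0⇒≢zeroV : ∀ {r} {v : Vec Carrier r} {i} → lookup v i ≢ 0# → v ≢ zeroV F
  coordinate≢0⇒≢zeroV {i = i} vi≢0 v≡0 = vi≢0 (trans (cong (λ w → lookup w i) v≡0) (lookup-zeroV i))

  OffAxes : ∀ {r} → Vec Carrier r → Set
  OffAxes v = ∀ i → ¬ (∃[ a ] v ≡ _•V_ F a (e F i))

  lookup-•e-≢ : ∀ {r} a {i j : Fin r} → i ≢ j → lookup (_•V_ F a (e F i)) j ≡ 0#
  lookup-•e-≢ a {i} {j} i≢j = begin
    lookup (_•V_ F a (e F i)) j  ≡⟨ lookup-•V a (e F i) j ⟩
    a ⋆ lookup (e F i) j         ≡⟨ cong (a ⋆_) (lookup-e-≢ i≢j) ⟩
    a ⋆ 0#                       ≡⟨ zeroʳ a ⟩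
    0#                           ∎

  lookup-•e-≡ : ∀ {r} a (i : Fin r) → lookup (_•V_ F a (e F i)) i ≡ a
  lookup-•e-≡ a i = begin
    lookup (_•V_ F a (e F i)) i  ≡⟨ lookup-•V a (e F i) i ⟩
    a ⋆ lookup (e F i) i         ≡⟨ cong (a ⋆_) (lookup-e-≡ i) ⟩
    a ⋆ 1#                       ≡⟨ *-identityʳ a ⟩
    a                            ∎

  two-coordinates≢0⇒offAxes : ∀ {r} {v : Vec Carrier r} {i j} → i ≢ j
    → lookup v i ≢ 0# → lookup v j ≢ 0# → OffAxes v
  two-coordinates≢0⇒offAxes {i = i} i≢j vi≢0 vj≢0 l (a , refl) with l ≟ᶠ i
  ... | no l≢i   = vi≢0 (lookup-•e-≢ a l≢i)
  ... | yes refl = vj≢0 (lookup-•e-≢ a i≢j)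

  offAxes⇒two-coordinates≢0 : ∀ {r} {v : Vec Carrier r} → v ≢ zeroV F → OffAxes v
    → ∃[ i ] ∃[ j ] i ≢ j × lookup v i ≢ 0# × lookup v j ≢ 0#
  offAxes⇒two-coordinates≢0 {v = v} v≢0 v-off-axes with any? (λ i → ¬? (lookup v i ≟ 0#))
  ... | no  v≡0  = ⊥-elim (v≢0 (≡-by-lookup λ l →
        trans (decidable-stable (lookup v l ≟ 0#) (λ vl≢0 → v≡0 (l , vl≢0))) (sym (lookup-zeroV l))))
  ... | yes (i , vi≢0) with any? (λ j → ¬? (i ≟ᶠ j) ×-dec ¬? (lookup v j ≟ 0#))
  ...   | yes (j , i≢j , vj≢0) = i , j , i≢j , vi≢0 , vj≢0
  ...   | no  v-on-axis-i      = ⊥-elim (v-off-axes i (lookup v i , ≡-by-lookup coordinate))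
    where
    coordinate : ∀ l → lookup v l ≡ lookup (_•V_ F (lookup v i) (e F i)) l
    coordinate l with i ≟ᶠ l
    ... | yes refl = sym (lookup-•e-≡ _ i)
    ... | no i≢l = trans (decidable-stable (lookup v l ≟ 0#) (λ vl≢0 → v-on-axis-i (l , i≢l , vl≢0)))
                         (sym (lookup-•e-≢ _ i≢l))

  twoPoint : ∀ {r} → Fin r → Fin r → Carrier → Carrier → Fin r → Carrier
  twoPoint i j b d l with l ≟ᶠ i | l ≟ᶠ j
  ... | yes _ | _     = b
  ... | no _  | yes _ = d
  ... | no _  | no _  = 0#

  twoPoint-elim : ∀ {r} (P : Fin r → Carrier → Set) {i j b d} → P i b → P j d → (∀ l → P l 0#)
    → ∀ l → P l (twoPoint i j b d l)
  twoPoint-elim P {i} {j} Pib Pjd P0 l with l ≟ᶠ i | l ≟ᶠ j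
  ... | yes refl | _        = Pib
  ... | no _     | yes refl = Pjd
  ... | no _     | no _     = P0 l

  twoPoint-at-i : ∀ {r} {i j : Fin r} {b d} → twoPoint i j b d i ≡ b
  twoPoint-at-i {i = i} {j} with i ≟ᶠ i | i ≟ᶠ j
  ... | yes _   | _ = refl
  ... | no i≢i  | _ = ⊥-elim (i≢i refl)

  twoPoint-at-j : ∀ {r} {i j : Fin r} {b d} → i ≢ j → twoPoint i j b d j ≡ d
  twoPoint-at-j {i = i} {j} i≢j with j ≟ᶠ i | j ≟ᶠ j
  ... | yes j≡i | _      = ⊥-elim (i≢j (sym j≡i))
  ... | no _    | yes _  = refl
  ... | no _    | no j≢j = ⊥-elim (j≢j refl)

  module WithSubfield {K : Pred Carrier 0ℓ} (K-subfield : IsSubfield F K) where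
    open IsSubfield K-subfield

    multiples-ratio∈K : ∀ {a b c d w} → K c → K d → a ≡ c ⋆ w → b ≡ d ⋆ w → b ≢ 0# → K (a / b)
    multiples-ratio∈K {a} {b} {c} {d} {w} c∈K d∈K a≡cw b≡dw b≢0 =
      subst K (sym (/-unique b≢0 c/d⋆b≡a)) (*-closed c∈K (inv-closed d∈K d≢0))
      where
      d≢0 : d ≢ 0#
      d≢0 d≡0 = b≢0 (trans b≡dw (trans (cong (_⋆ w) d≡0) (zeroˡ w)))
      c/d⋆b≡a : c / d ⋆ b ≡ a
      c/d⋆b≡a = begin
        c / d ⋆ b        ≡⟨ cong (c / d ⋆_) b≡dw ⟩
        c / d ⋆ (d ⋆ w)  ≡⟨ *-assoc _ d w ⟨
        c / d ⋆ d ⋆ w    ≡⟨ cong (_⋆ w) (x/y⋆y≡x c d≢0) ⟩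
        c ⋆ w            ≡⟨ a≡cw ⟨
        a                ∎

    RatioClosed : Pred Carrier 0ℓ → Set
    RatioClosed W = ∀ {a b} → W a → W b → b ≢ 0# → K (a / b)

    MultipliersMeetInK : Pred Carrier 0ℓ → Pred Carrier 0ℓ → Set
    MultipliersMeetInK U V = ∀ {x} → Multiplier U x → Multiplier V x → K x

    multipliersMeetInK⇒ratioClosed : ∀ {U V} → MultipliersMeetInK U V
      → ∀ {α} → RatioClosed (_∩_ F U (scaleSet F α V))
    multipliersMeetInK⇒ratioClosed {U} {V} meet {α} {a} {b}
      (a∈U , u , u∈V , a≡αu) (b∈U , u′ , u′∈V , b≡αu′) b≢0 =
      meet (b , b≢0 , b∈U , subst U (sym (x/y⋆y≡x a b≢0)) a∈U)
           (u′ , u′≢0 , u′∈V , subst V (sym a/b⋆u′≡u) u∈V)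
      where
      u′≢0 : u′ ≢ 0#
      u′≢0 u′≡0 = b≢0 (trans b≡αu′ (trans (cong (α ⋆_) u′≡0) (zeroʳ α)))
      a/b≡u/u′ : a / b ≡ u / u′
      a/b≡u/u′ = /-unique b≢0 (begin
        u / u′ ⋆ b          ≡⟨ cong (u / u′ ⋆_) b≡αu′ ⟩
        u / u′ ⋆ (α ⋆ u′)   ≡⟨ x∙yz≈y∙xz _ α u′ ⟩
        α ⋆ (u / u′ ⋆ u′)   ≡⟨ cong (α ⋆_) (x/y⋆y≡x u u′≢0) ⟩
        α ⋆ u               ≡⟨ a≡αu ⟨
        a                   ∎)
      a/b⋆u′≡u : a / b ⋆ u′ ≡ u
      a/b⋆u′≡u = trans (cong (_⋆ u′) a/b≡u/u′) (x/y⋆y≡x u u′≢0)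

    ratioClosed⇒multipliersMeetInK : ∀ {U V} → (∀ {α} → α ≢ 0# → RatioClosed (_∩_ F U (scaleSet F α V)))
      → MultipliersMeetInK U V
    ratioClosed⇒multipliersMeetInK {U} {V} ratioClosed {x} (b , b≢0 , b∈U , xb∈U) (d , d≢0 , d∈V , xd∈V) =
      subst K (/-unique b≢0 refl)
        (ratioClosed (/≢0 b≢0 d≢0) (xb∈U , x ⋆ d , xd∈V , xb≡α[xd]) (b∈U , d , d∈V , b≡αd) b≢0)
      where
      b≡αd : b ≡ b / d ⋆ d
      b≡αd = sym (x/y⋆y≡x b d≢0)
      xb≡α[xd] : x ⋆ b ≡ b / d ⋆ (x ⋆ d)
      xb≡α[xd] = trans (cong (x ⋆_) b≡αd) (x∙yz≈y∙xz x _ d)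

    lincomb∈ : ∀ {V} {O : VOps F V} {U} → IsSubspace F K O U
      → ∀ {k} {c : Vec Carrier k} {b} → All K c → All U b → U (lincomb F K O c b)
    lincomb∈ U-subspace {c = []}    {[]}    []           []           = IsSubspace.zero∈ U-subspace
    lincomb∈ U-subspace {c = _ ∷ _} {_ ∷ _} (c∈K ∷ cs∈K) (b∈U ∷ bs∈U) =
      IsSubspace.⊕-closed U-subspace (IsSubspace.•-closed U-subspace c∈K b∈U) (lincomb∈ U-subspace cs∈K bs∈U)

    zeros∈K : ∀ {k} → All K (zeroV F {k})
    zeros∈K {zero}  = []
    zeros∈K {suc k} = 0∈ ∷ zeros∈K

    lincomb-zeros : ∀ {k} (b : Vec Carrier k) → lincomb F K (opsF F) (zeroV F) b ≡ 0#
    lincomb-zeros []      = refl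
    lincomb-zeros (b ∷ bs) = trans (cong₂ _+_ (zeroˡ b) (lincomb-zeros bs)) (+-identityʳ 0#)

    positive-dim⇒nonzero : ∀ {U k} → 1 ≤ k → HasDim F K (opsF F) U k → ∃[ u ] u ≢ 0# × U u
    positive-dim⇒nonzero {k = suc k} _ (b ∷ bs , b∈U ∷ _ , independent , _) = b , b≢0 , b∈U
      where
      b≢0 : b ≢ 0#
      b≢0 b≡0 with independent (1# ∷ zeroV F) (1∈ ∷ zeros∈K)
                     (trans (cong₂ _+_ (trans (*-identityˡ b) b≡0) (lincomb-zeros bs)) (+-identityʳ 0#))
      ... | 1≡0 ∷ _ = 0≢1 (sym 1≡0)

    ∃-K-vector? : ∀ {m} → Card K m → ∀ k {P : Pred (Vec Carrier k) 0ℓ} → Decidable P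
      → Dec (∃[ c ] All K c × P c)
    ∃-K-vector? _ zero P? = map′ (λ p → [] , [] , p) (λ { ([] , [] , p) → p }) (P? [])
    ∃-K-vector? K-finite (suc k) P? = map′
      (λ (x , x∈K , c , c∈K , p) → x ∷ c , x∈K ∷ c∈K , p)
      (λ { (x ∷ c , x∈K ∷ c∈K , p) → x , x∈K , c , c∈K , p })
      (∃-finite? K-finite (λ x → ∃-K-vector? K-finite k (P? ∘ (x ∷_))))

    finite-dim⇒decidable : ∀ {m U k} → Card K m → IsSubspace F K (opsF F) U → HasDim F K (opsF F) U k
      → Decidable U
    finite-dim⇒decidable {U = U} {k} K-finite U-subspace (b , b∈U , _ , spanning) w = map′
      (λ (c , c∈K , w≡cb) → subst U (sym w≡cb) (lincomb∈ U-subspace c∈K b∈U))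
      (spanning w)
      (∃-K-vector? K-finite k (λ c → w ≟ lincomb F K (opsF F) c b))

    dim≤1⇒ratioClosed : ∀ {W} → DimAtMost F K (opsF F) W 1 → RatioClosed W
    dim≤1⇒ratioClosed (zero , _ , [] , _ , _ , spanning) {b = b} _ b∈W b≢0 with spanning b b∈W
    ... | [] , [] , b≡0 = ⊥-elim (b≢0 b≡0)
    dim≤1⇒ratioClosed (suc zero , _ , w ∷ [] , _ , _ , spanning) {a} {b} a∈W b∈W b≢0
      with spanning a a∈W | spanning b b∈W
    ... | c ∷ [] , c∈K ∷ [] , a≡cw | d ∷ [] , d∈K ∷ [] , b≡dw =
      multiples-ratio∈K c∈K d∈K (trans a≡cw (+-identityʳ _)) (trans b≡dw (+-identityʳ _)) b≢0
    dim≤1⇒ratioClosed (suc (suc _) , s≤s () , _)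

    -- Exhibiting a basis requires deciding whether W is zero; this is where the finiteness of
    -- 𝔽_{q^n} is used (that of 𝔽_q makes the U_i decidable).
    ratioClosed⇒dim≤1 : ∀ {m W} → Card (⊤′ F) m → Decidable W → RatioClosed W → DimAtMost F K (opsF F) W 1
    ratioClosed⇒dim≤1 {W = W} F-finite W? ratioClosed with ∃-finite? F-finite (λ x → ¬? (x ≟ 0#) ×-dec W? x)
    ... | yes (x₀ , _ , x₀≢0 , x₀∈W) = 1 , ≤-refl , x₀ ∷ [] , x₀∈W ∷ [] , independent , spanning
      where
      independent : ∀ (c : Vec Carrier 1) → All K c → lincomb F K (opsF F) c (x₀ ∷ []) ≡ 0# → All (_≡ 0#) c
      independent (c ∷ []) _ cx₀+0≡0 = x⋆y≡0⇒x≡0 x₀≢0 (trans (sym (+-identityʳ _)) cx₀+0≡0) ∷ []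
      spanning : ∀ w → W w → ∃[ c ] All K c × w ≡ lincomb F K (opsF F) c (x₀ ∷ [])
      spanning w w∈W = w / x₀ ∷ [] , ratioClosed w∈W x₀∈W x₀≢0 ∷ [] ,
                       sym (trans (+-identityʳ _) (x/y⋆y≡x w x₀≢0))
    ... | no W⊆0 = 0 , z≤n , [] , [] , (λ { [] [] _ → [] }) , λ w w∈W → [] , [] ,
      decidable-stable (w ≟ 0#) (λ w≢0 → W⊆0 (w , tt , w≢0 , w∈W))

    lookup-lincomb₁ : ∀ {r} c (u : Vec Carrier r) l
      → lookup (lincomb F K (opsVec F r) (c ∷ []) (u ∷ [])) l ≡ c ⋆ lookup u l
    lookup-lincomb₁ c u l = trans (cong (λ w → lookup w l) (+V-identityʳ (_•V_ F c u))) (lookup-•V c u l)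

    dim1⇒scalar∈K : ∀ {r W} {w : Vec Carrier r} {x l} → HasDim F K (opsVec F r) W 1
      → W w → W (_•V_ F x w) → lookup w l ≢ 0# → K x
    dim1⇒scalar∈K {w = w} {x} {l} (u ∷ [] , _ , _ , spanning) w∈W xw∈W wl≢0
      with spanning w w∈W | spanning (_•V_ F x w) xw∈W
    ... | c ∷ [] , c∈K ∷ [] , w≡cu | c′ ∷ [] , c′∈K ∷ [] , xw≡c′u =
      subst K (/-unique wl≢0 refl) (multiples-ratio∈K c′∈K c∈K xwl≡c′ul wl≡cul wl≢0)
      where
      wl≡cul : lookup w l ≡ c ⋆ lookup u l
      wl≡cul = trans (cong (λ v → lookup v l) w≡cu) (lookup-lincomb₁ c u l)
      xwl≡c′ul : x ⋆ lookup w l ≡ c′ ⋆ lookup u l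
      xwl≡c′ul = trans (sym (lookup-•V x w l))
        (trans (cong (λ v → lookup v l) xw≡c′u) (lookup-lincomb₁ c′ u l))

module Product (F : Field) {K : Pred (Field.Carrier F) 0ℓ} (K-subfield : IsSubfield F K)
  {r : ℕ} (Us : Fin r → Pred (Field.Carrier F) 0ℓ) (Us-subspace : ∀ i → IsSubspace F K (opsF F) (Us i)) where
  open Field F renaming (_*_ to _⋆_)
  open IsCommutativeRing isCommutativeRing using (zeroʳ)
  open FieldProperties F
  open WithSubfield K-subfield

  WeightOne : Set
  WeightOne = ∀ (v : Vec Carrier r) → prodSpace F Us v → v ≢ zeroV F → OffAxes v
    → HasDim F K (opsVec F r) (_∩_ F (prodSpace F Us) (span1 F v)) 1

  QuotientsMeetInK : Set
  QuotientsMeetInK = ∀ (i j : Fin r) → i ≢ j → ∀ x →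
    ((_·_⁻¹ˢ F (Us i) (Us i) x × _·_⁻¹ˢ F (Us j) (Us j) x) ⇔ K x)

  IntersectionsDim≤1 : Set
  IntersectionsDim≤1 = ∀ (α : Carrier) → α ≢ 0# → ∀ (i j : Fin r) → i ≢ j →
    DimAtMost F K (opsF F) (_∩_ F (Us i) (scaleSet F α (Us j))) 1

  AllMultipliersMeetInK : Set
  AllMultipliersMeetInK = ∀ (i j : Fin r) → i ≢ j → MultipliersMeetInK (Us i) (Us j)

  weightOne⇒multipliersMeetInK : WeightOne → AllMultipliersMeetInK
  weightOne⇒multipliersMeetInK weightOne i j i≢j {x} (b , b≢0 , b∈Ui , xb∈Ui) (d , d≢0 , d∈Uj , xd∈Uj) =
    dim1⇒scalar∈K
      (weightOne v v∈U (coordinate≢0⇒≢zeroV vi≢0) (two-coordinates≢0⇒offAxes i≢j vi≢0 vj≢0))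
      (v∈U , 1# , sym (•V-identityˡ v)) (xv∈U , x , refl) vi≢0
    where
    v : Vec Carrier r
    v = tabulate (twoPoint i j b d)
    vi≢0 : lookup v i ≢ 0#
    vi≢0 = b≢0 ∘ trans (sym (trans (lookup∘tabulate _ i) (twoPoint-at-i {i = i} {j} {d = d})))
    vj≢0 : lookup v j ≢ 0#
    vj≢0 = d≢0 ∘ trans (sym (trans (lookup∘tabulate _ j) (twoPoint-at-j i≢j)))
    0∈U : ∀ l → Us l 0#
    0∈U l = IsSubspace.zero∈ (Us-subspace l)
    v∈U : prodSpace F Us v
    v∈U l = subst (Us l) (sym (lookup∘tabulate _ l)) (twoPoint-elim Us b∈Ui d∈Uj 0∈U l)
    xv∈U : prodSpace F Us (_•V_ F x v)
    xv∈U l = subst (Us l) (sym (trans (lookup-•V x v l) (cong (x ⋆_) (lookup∘tabulate _ l))))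
      (twoPoint-elim (λ l y → Us l (x ⋆ y)) xb∈Ui xd∈Uj (λ l → subst (Us l) (sym (zeroʳ x)) (0∈U l)) l)

  multipliersMeetInK⇒weightOne : AllMultipliersMeetInK → WeightOne
  multipliersMeetInK⇒weightOne meet v v∈U v≢0 v-off-axes with offAxes⇒two-coordinates≢0 v≢0 v-off-axes
  ... | i , j , i≢j , vi≢0 , vj≢0 = v ∷ [] , (v∈U , 1# , sym (•V-identityˡ v)) ∷ [] , independent , spanning
    where
    independent : ∀ (c : Vec Carrier 1) → All K c → lincomb F K (opsVec F r) c (v ∷ []) ≡ zeroV F
      → All (_≡ 0#) c
    independent (c ∷ []) _ cv≡0 = x⋆y≡0⇒x≡0 vi≢0
      (trans (sym (lookup-lincomb₁ c v i)) (trans (cong (λ w → lookup w i) cv≡0) (lookup-zeroV i))) ∷ []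
    spanning : ∀ w → _∩_ F (prodSpace F Us) (span1 F v) w
      → ∃[ c ] All K c × w ≡ lincomb F K (opsVec F r) c (v ∷ [])
    spanning w (w∈U , a , w≡av) = a ∷ [] , a∈K ∷ [] , trans w≡av (sym (+V-identityʳ _))
      where
      multiplier-at : ∀ {l} → lookup v l ≢ 0# → Multiplier (Us l) a
      multiplier-at {l} vl≢0 =
        lookup v l , vl≢0 , v∈U l ,
        subst (Us l) (trans (cong (λ u → lookup u l) w≡av) (lookup-•V a v l)) (w∈U l)
      a∈K : K a
      a∈K = meet i j i≢j (multiplier-at vi≢0) (multiplier-at vj≢0)

  weightOne⇔multipliersMeetInK : WeightOne ⇔ AllMultipliersMeetInK
  weightOne⇔multipliersMeetInK = mk⇔ weightOne⇒multipliersMeetInK multipliersMeetInK⇒weightOne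

  multipliersMeetInK⇔quotientsMeetInK : (∀ i → ∃[ u ] u ≢ 0# × Us i u)
    → AllMultipliersMeetInK ⇔ QuotientsMeetInK
  multipliersMeetInK⇔quotientsMeetInK Us-nonzero = mk⇔
    (λ meet i j i≢j x → mk⇔
      (λ (x∈UiUi⁻¹ , x∈UjUj⁻¹) → meet i j i≢j (Equivalence.to quotient⇔multiplier x∈UiUi⁻¹)
                                               (Equivalence.to quotient⇔multiplier x∈UjUj⁻¹))
      (λ x∈K → Equivalence.from quotient⇔multiplier (K⊆multipliers i x∈K) ,
               Equivalence.from quotient⇔multiplier (K⊆multipliers j x∈K)))
    (λ quotientsMeet i j i≢j {x} x∈Mi x∈Mj → Equivalence.to (quotientsMeet i j i≢j x)
      (Equivalence.from quotient⇔multiplier x∈Mi , Equivalence.from quotient⇔multiplier x∈Mj))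
    where
    K⊆multipliers : ∀ i {x} → K x → Multiplier (Us i) x
    K⊆multipliers i x∈K = let u , u≢0 , u∈Ui = Us-nonzero i in
      u , u≢0 , u∈Ui , IsSubspace.•-closed (Us-subspace i) x∈K u∈Ui

  multipliersMeetInK⇔dim≤1 : ∀ {m} → Card (⊤′ F) m → (∀ i → Decidable (Us i))
    → AllMultipliersMeetInK ⇔ IntersectionsDim≤1
  multipliersMeetInK⇔dim≤1 F-finite Us? = mk⇔
    (λ meet α α≢0 i j i≢j → ratioClosed⇒dim≤1 F-finite (scaled-∩? α≢0 (Us? i) (Us? j))
                              (multipliersMeetInK⇒ratioClosed (meet i j i≢j)))
    (λ dim≤1 i j i≢j {x} →
      ratioClosed⇒multipliersMeetInK (λ {α} α≢0 → dim≤1⇒ratioClosed (dim≤1 α α≢0 i j i≢j)) {x})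

theorem7p2 : (F : Field) (K : Pred (Field.Carrier F) 0ℓ) (q n r : ℕ)
    → IsPrimePower q → 1 ≤ n → 1 ≤ r
    → IsSubfield F K → Card K q → Card (⊤′ F) (q ^ n)
    → (Us : Fin r → Pred (Field.Carrier F) 0ℓ) (ks : Vec ℕ r)
    → (∀ i → IsSubspace F K (opsF F) (Us i))
    → (∀ i → HasDim F K (opsF F) (Us i) (lookup ks i))
    → (∀ i → 2 ≤ lookup ks i)
    → sumℕ ks ≤ (r ∸ 1) * n
    → let open Field F in
      ((∀ (v : Vec Carrier r) → prodSpace F Us v → v ≢ zeroV F
          → (∀ i → ¬ Σ Carrier (λ a → v ≡ _•V_ F a (e F i)))
          → HasDim F K (opsVec F r) (_∩_ F (prodSpace F Us) (span1 F v)) 1)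
       ⇔ (∀ (i j : Fin r) → i ≢ j → ∀ x →
            ((_·_⁻¹ˢ F (Us i) (Us i) x × _·_⁻¹ˢ F (Us j) (Us j) x) ⇔ K x)))
      × ((∀ (i j : Fin r) → i ≢ j → ∀ x →
            ((_·_⁻¹ˢ F (Us i) (Us i) x × _·_⁻¹ˢ F (Us j) (Us j) x) ⇔ K x))
       ⇔ (∀ (α : Carrier) → α ≢ 0# → ∀ (i j : Fin r) → i ≢ j →
            DimAtMost F K (opsF F) (_∩_ F (Us i) (scaleSet F α (Us j))) 1))
theorem7p2 F K q n r _ _ _ K-subfield K-finite F-finite Us ks Us-subspace Us-dim 2≤ks _ =
  ⇔.trans weightOne⇔multipliersMeetInK (multipliersMeetInK⇔quotientsMeetInK Us-nonzero) ,
  ⇔.trans (⇔.sym (multipliersMeetInK⇔quotientsMeetInK Us-nonzero)) (multipliersMeetInK⇔dim≤1 F-finite Us?)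
  where
  open FieldProperties F
  open WithSubfield K-subfield
  open Product F K-subfield Us Us-subspace
  Us-nonzero : ∀ i → ∃[ u ] u ≢ Field.0# F × Us i u
  Us-nonzero i = positive-dim⇒nonzero (<⇒≤ (2≤ks i)) (Us-dim i)
  Us? : ∀ i → Decidable (Us i)
  Us? i = finite-dim⇒decidable K-finite (Us-subspace i) (Us-dim i)
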